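{- For every $n\ge1$, the number of binary words $w$ (of any length $m\ge1$) with no two consecutive $1$'s such that $\mathrm{area}(P(w))=n$ equals $b_{n+1}$, where $(b_m)_{m\ge0}$ is Narayana's cows sequence defined by $b_0=b_1=b_2=1$ and $b_m=b_{m-1}+b_{m-3}$ for $m\ge3$ (equivalently $\sum_{m\ge0}b_mx^m=1/(1-x-x^3)$).
   Context: For a binary word $w=w_1\cdots w_m$, $P(w)$ is the bargraph polyomino whose $i$-th column consists of $w_i+1$ unit cells, and $\mathrm{area}(P(w))$ is its number of cells, i.e. $m+w_1+\dots+w_m$. -}

module Defs where

open import Data.Bool using (Bool; true; false)
open import Data.Nat using (ℕ; zero; suc; _+_; _≤_)
open import Data.List using (List; []; _∷_; length)
open import Data.Product using (Σ; _×_)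
open import Relation.Binary.PropositionalEquality using (_≡_)

bit : Bool → ℕ
bit false = 0
bit true  = 1

-- area of the bargraph P(w): m + w_1 + ... + w_m (column i has w_i + 1 cells)
area : List Bool → ℕ
area []      = 0
area (b ∷ w) = suc (bit b) + area w

data NoConsecOnes : List Bool → Set where
  nil    : NoConsecOnes []
  single : ∀ b → NoConsecOnes (b ∷ [])
  zero∷  : ∀ {c w} → NoConsecOnes (c ∷ w) → NoConsecOnes (false ∷ c ∷ w)
  one0∷  : ∀ {w} → NoConsecOnes (false ∷ w) → NoConsecOnes (true ∷ false ∷ w)

narayana : ℕ → ℕ
narayana 0 = 1
narayana 1 = 1
narayana 2 = 1
narayana (suc (suc (suc m))) = narayana (suc (suc m)) + narayana m

Words : ℕ → Set
Words n = Σ (List Bool) (λ w → (1 ≤ length w) × NoConsecOnes w × (area w ≡ n))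

{-# OPTIONS --safe #-}
-- A nonempty word avoiding 11 begins either with 0 or with 10, and deleting that
-- prefix lowers the area by 1 or by 3 respectively.  Hence the number a(k) of such
-- words of area k satisfies a(k+3) = a(k+2) + a(k), with a(0) = a(1) = 1 (the empty
-- word and 0) and a(2) = 2 (00 and 1), so a(k) = b(k+1).  Positive area forces a
-- nonempty word, so for n ≥ 1 the empty word does not interfere.
module Submission where

open import Defs
open import Data.Nat using (ℕ; suc; _≤_)
open import Data.Fin using (Fin)
open import Function.Bundles using (_↔_)

open import Data.Bool using (Bool; true; false)
open import Data.Fin using (zero; suc)
open import Data.Fin.Properties using (+↔⊎)
open import Data.List using (List; []; _∷_; length)
open import Data.Nat using (_+_; z≤n; s≤s)
open import Data.Nat.Properties using (≤-irrelevant; ≡-irrelevant; suc-injective)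
open import Data.Product using (Σ; _×_; _,_)
open import Data.Sum using (_⊎_; inj₁; inj₂)
open import Data.Sum.Function.Propositional using (_⊎-↔_)
open import Function.Bundles using (mk↔ₛ′)
open import Function.Properties.Inverse using (↔-sym; ↔-trans)
open import Relation.Binary.PropositionalEquality using (_≡_; refl; sym; cong; cong₂; subst)

NoConsecOnes-irrelevant : ∀ {w} (p q : NoConsecOnes w) → p ≡ q
NoConsecOnes-irrelevant nil        nil         = refl
NoConsecOnes-irrelevant (single b) (single .b) = refl
NoConsecOnes-irrelevant (zero∷ p)  (zero∷ q)   = cong zero∷ (NoConsecOnes-irrelevant p q)
NoConsecOnes-irrelevant (one0∷ p)  (one0∷ q)   = cong one0∷ (NoConsecOnes-irrelevant p q)

false∷-NoConsecOnes : ∀ {w} → NoConsecOnes w → NoConsecOnes (false ∷ w)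
false∷-NoConsecOnes nil        = single false
false∷-NoConsecOnes (single b) = zero∷ (single b)
false∷-NoConsecOnes (zero∷ p)  = zero∷ (zero∷ p)
false∷-NoConsecOnes (one0∷ p)  = zero∷ (one0∷ p)

false∷⁻-NoConsecOnes : ∀ {w} → NoConsecOnes (false ∷ w) → NoConsecOnes w
false∷⁻-NoConsecOnes (single .false) = nil
false∷⁻-NoConsecOnes (zero∷ p)       = p

0<area⇒nonempty : ∀ w → 1 ≤ area w → 1 ≤ length w
0<area⇒nonempty []      ()
0<area⇒nonempty (_ ∷ _) _ = s≤s z≤n

AvoidingOfArea : ℕ → Set
AvoidingOfArea k = Σ (List Bool) (λ w → NoConsecOnes w × area w ≡ k)

AvoidingOfArea-≡ : ∀ {k w} {p q : NoConsecOnes w} {e e′ : area w ≡ k} →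
                   _≡_ {A = AvoidingOfArea k} (w , p , e) (w , q , e′)
AvoidingOfArea-≡ {p = p} {q} {e} {e′} =
  cong₂ (λ p e → (_ , p , e)) (NoConsecOnes-irrelevant p q) (≡-irrelevant e e′)

Fin1↔-contractible : ∀ {A : Set} (c : A) → (∀ x → c ≡ x) → Fin 1 ↔ A
Fin1↔-contractible c contract = mk↔ₛ′ (λ _ → c) (λ _ → zero) contract λ { zero → refl ; (suc ()) }

Fin1↔AvoidingOfArea0 : Fin 1 ↔ AvoidingOfArea 0
Fin1↔AvoidingOfArea0 = Fin1↔-contractible ([] , nil , refl) contract
  where
  contract : ∀ x → ([] , nil , refl) ≡ x
  contract ([]    , _ , _)  = AvoidingOfArea-≡
  contract (_ ∷ _ , _ , ())

Fin1↔AvoidingOfArea1 : Fin 1 ↔ AvoidingOfArea 1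
Fin1↔AvoidingOfArea1 = Fin1↔-contractible (false ∷ [] , single false , refl) contract
  where
  contract : ∀ x → (false ∷ [] , single false , refl) ≡ x
  contract ([]                , _ , ())
  contract (false ∷ []        , _ , _)  = AvoidingOfArea-≡
  contract (false ∷ _ ∷ _     , _ , ())
  contract (true ∷ _          , _ , ())

Fin2↔AvoidingOfArea2 : Fin 2 ↔ AvoidingOfArea 2
Fin2↔AvoidingOfArea2 = mk↔ₛ′ to from to∘from from∘to
  where
  to : Fin 2 → AvoidingOfArea 2
  to zero       = false ∷ false ∷ [] , zero∷ (single false) , refl
  to (suc zero) = true ∷ [] , single true , refl

  from : AvoidingOfArea 2 → Fin 2
  from ([]        , _ , ())
  from (false ∷ _ , _)      = zero
  from (true ∷ _  , _)      = suc zero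

  to∘from : ∀ x → to (from x) ≡ x
  to∘from ([]                     , _ , ())
  to∘from (false ∷ []             , _ , ())
  to∘from (false ∷ false ∷ []     , _ , _)  = AvoidingOfArea-≡
  to∘from (false ∷ false ∷ _ ∷ _  , _ , ())
  to∘from (false ∷ true ∷ _       , _ , ())
  to∘from (true ∷ []              , _ , _)  = AvoidingOfArea-≡
  to∘from (true ∷ _ ∷ _           , _ , ())

  from∘to : ∀ i → from (to i) ≡ i
  from∘to zero       = refl
  from∘to (suc zero) = refl

AvoidingOfArea-split : ∀ k →
  (AvoidingOfArea (suc (suc k)) ⊎ AvoidingOfArea k) ↔ AvoidingOfArea (suc (suc (suc k)))
AvoidingOfArea-split k = mk↔ₛ′ prepend strip prepend∘strip strip∘prepend
  where
  prepend : AvoidingOfArea (suc (suc k)) ⊎ AvoidingOfArea k → AvoidingOfArea (suc (suc (suc k)))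
  prepend (inj₁ (w , p , e)) = false ∷ w , false∷-NoConsecOnes p , cong suc e
  prepend (inj₂ (w , p , e)) = true ∷ false ∷ w , one0∷ (false∷-NoConsecOnes p) , cong (3 +_) e

  strip : AvoidingOfArea (suc (suc (suc k))) → AvoidingOfArea (suc (suc k)) ⊎ AvoidingOfArea k
  strip ([]                 , _ , ())
  strip (false ∷ w          , p , e)  = inj₁ (w , false∷⁻-NoConsecOnes p , suc-injective e)
  strip (true ∷ []          , _ , ())
  strip (true ∷ false ∷ w   , one0∷ p , e) =
    inj₂ (w , false∷⁻-NoConsecOnes p , suc-injective (suc-injective (suc-injective e)))
  strip (true ∷ true ∷ _    , () , _)

  prepend∘strip : ∀ x → prepend (strip x) ≡ x
  prepend∘strip ([]               , _ , ())
  prepend∘strip (false ∷ _        , _ , _)       = AvoidingOfArea-≡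
  prepend∘strip (true ∷ []        , _ , ())
  prepend∘strip (true ∷ false ∷ _ , one0∷ _ , _) = AvoidingOfArea-≡
  prepend∘strip (true ∷ true ∷ _  , () , _)

  strip∘prepend : ∀ x → strip (prepend x) ≡ x
  strip∘prepend (inj₁ _) = cong inj₁ AvoidingOfArea-≡
  strip∘prepend (inj₂ _) = cong inj₂ AvoidingOfArea-≡

narayana↔AvoidingOfArea : ∀ k → Fin (narayana (suc k)) ↔ AvoidingOfArea k
narayana↔AvoidingOfArea 0             = Fin1↔AvoidingOfArea0
narayana↔AvoidingOfArea 1             = Fin1↔AvoidingOfArea1
narayana↔AvoidingOfArea 2             = Fin2↔AvoidingOfArea2
narayana↔AvoidingOfArea (suc (suc (suc k))) =
  ↔-trans +↔⊎
    (↔-trans (narayana↔AvoidingOfArea (suc (suc k)) ⊎-↔ narayana↔AvoidingOfArea k)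
             (AvoidingOfArea-split k))

Words↔AvoidingOfArea : ∀ n → 1 ≤ n → Words n ↔ AvoidingOfArea n
Words↔AvoidingOfArea n 1≤n = mk↔ₛ′ forget remember (λ _ → refl) remember∘forget
  where
  forget : Words n → AvoidingOfArea n
  forget (w , _ , p , e) = w , p , e

  remember : AvoidingOfArea n → Words n
  remember (w , p , e) = w , 0<area⇒nonempty w (subst (1 ≤_) (sym e) 1≤n) , p , e

  remember∘forget : ∀ x → remember (forget x) ≡ x
  remember∘forget (w , l , p , e) = cong (λ l → w , l , p , e) (≤-irrelevant _ _)

theorem1p5 : (n : ℕ) → 1 ≤ n → Fin (narayana (suc n)) ↔ Words n
theorem1p5 n 1≤n = ↔-trans (narayana↔AvoidingOfArea n) (↔-sym (Words↔AvoidingOfArea n 1≤n))
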